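{- In the game graph $G'_{\phi,K,C}$, for all $F\in\mathcal F$, $\sigma\in\Sigma_I\cup\Sigma_O$ and $c\in\mathcal C$, $\mathsf{Pre}_\sigma(\downarrow(F,\sigma,c))=\downarrow\Omega(F,\sigma,c)$.
   Context: Let $P=I\uplus O$, $\Sigma_P=2^P$, $\Sigma_I=2^I$, $\Sigma_O=2^O$, let $w:\mathrm{Lit}(P)\to\mathbb{Z}$ be extended to $\Sigma_I$ by $w(i)=\sum_{p\in i}w(p)+\sum_{p\in I\setminus i}w(\neg p)$ and similarly to $\Sigma_O$. Let $\mathcal A=(\Sigma_P,Q,q_0,\alpha,\delta)$ be an automaton ($\delta:Q\times\Sigma_P\to2^Q$) and $K,C\in\mathbb{N}$. $\mathcal K=\{ -1,0,\dots,K,\top\}$ ($\top>K$); $\mathcal F$ is the set of maps $Q\to\mathcal K$ ordered pointwise; $F_0(q)=-1$ for $q\ne q_0$, $F_0(q_0)=1$ if $q_0\in\alpha$ else $0$; $\Delta(F,\sigma)(q)=\max\{F(p)\oplus[q\in\alpha]\mid q\in\delta(p,\sigma)\}$ (max of empty set $=-1$), with $k\oplus b=-1$ if $k=-1$, $k+b$ if $k\notin\{ -1,\top\}$ and $k+b\le K$, $\top$ otherwise. $\mathcal C=\{\bot,0,\dots,C\}$ with $\bot<0$, and $c\oplus k=\min(C,c+k)$ if $c\ne\bot$ and $c+k\ge0$, else $\bot$. $G'_{\phi,K,C}$ has Player-1 states $S_1=\{(F,i,c)\}$ ($F\in\mathcal F,i\in\Sigma_I,c\in\mathcal C$), Player-2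 states $S_2=\{(F,o,c)\}$ ($o\in\Sigma_O$), treated as disjoint, initial state $(F_0,j_0,C)$, and edges $((F,j,c),(F,o,c\oplus w(o)))$ and $((F,o,c),(\Delta(F,o\cup i),i,c\oplus w(i)))$ for all $F,j,c,o,i$. Partial order: $(F',\sigma,c')\preceq(F,\sigma,c)$ iff same part and same $\sigma$, $F'\le F$ pointwise and $c'\ge c$; $\downarrow L=\{s'\mid\exists s\in L,\ s'\preceq s\}$, and $\downarrow s=\downarrow\{s\}$. For $o\in\Sigma_O$, $\mathsf{Pre}_o(L)=\{s\in S_1\mid (s,s')\in E$ for some $s'=(F,o,c)\in L\}$; for $i\in\Sigma_I$, $\mathsf{Pre}_i(L)=\{s\in S_2\mid (s,s')\in E$ for some $s'=(F,i,c)\in L\}$. For $(F,o,c)\in S_2$: $\Omega(F,o,c)=\{(F,i,c')\mid i\in\Sigma_I\}$ with $c'=\min\{d\in\mathcal C\mid d\oplus w(o)\ge c\}$ if this set is nonempty, and $\Omega(F,o,c)=\emptyset$ otherwise. For $(F,i,c)\in S_1$: $\Omega(F,i,c)=\{(F'_o,o,c')\mid o\in\Sigma_O\}$ with $F'_o=\max\{G\in\mathcal F\mid\Delta(G,o\cup i)\le F\}$ (this maximum exists) and $c'=\min\{d\in\mathcal C\mid d\oplus w(i)\ge c\}$ if this set is nonempty, and $\Omega(F,i,c)=\emptyset$ otherwise. -}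

module Defs where

open import Level using (0ℓ)
open import Data.Bool using (Bool; true; false; if_then_else_)
open import Data.Nat as ℕ using (ℕ; suc; _⊓_; _≤ᵇ_; _≤?_)
open import Data.Nat.Properties using (m⊓n≤m)
open import Data.Integer as ℤ using (ℤ; +_; -[1+_])
open import Data.Fin using (Fin; toℕ; fromℕ<; _↑ˡ_; _↑ʳ_)
open import Data.Fin.Subset using (Subset)
open import Data.Vec using (lookup; _++_)
open import Data.List using (foldr; allFin)
open import Data.Product using (Σ; _×_; ∃; _,_)
open import Data.Empty using (⊥)
open import Data.Unit using (⊤)
open import Relation.Nullary using (yes; no)
open import Relation.Binary.PropositionalEquality using (_≡_)
open import Relation.Unary using (Pred; ｛_｝)

-- 𝒦 = {-1,0,…,K,⊤}

data KVal (K : ℕ) : Set where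
  neg : KVal K
  fin : Fin (suc K) → KVal K
  top : KVal K

data _≤ᴷ_ {K : ℕ} : KVal K → KVal K → Set where
  neg≤   : ∀ {x} → neg ≤ᴷ x
  fin≤   : ∀ {a b} → toℕ a ℕ.≤ toℕ b → fin a ≤ᴷ fin b
  fin≤⊤ : ∀ {a} → fin a ≤ᴷ top
  ⊤≤⊤   : top ≤ᴷ top

maxᴷ : ∀ {K} → KVal K → KVal K → KVal K
maxᴷ neg y = y
maxᴷ top y = top
maxᴷ (fin a) neg = fin a
maxᴷ (fin a) top = top
maxᴷ (fin a) (fin b) = if toℕ a ≤ᵇ toℕ b then fin b else fin a

bit : Bool → ℕ
bit true = 1
bit false = 0

_⊕ᴷ_ : ∀ {K} → KVal K → Bool → KVal K
neg ⊕ᴷ b = neg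
top ⊕ᴷ b = top
_⊕ᴷ_ {K} (fin k) b with toℕ k ℕ.+ bit b ≤? K
... | yes p = fin (fromℕ< (ℕ.s≤s p))
... | no _  = top

data CVal (C : ℕ) : Set where
  bot : CVal C
  val : Fin (suc C) → CVal C

data _≤ᶜ_ {C : ℕ} : CVal C → CVal C → Set where
  bot≤ : ∀ {x} → bot ≤ᶜ x
  val≤ : ∀ {a b} → toℕ a ℕ.≤ toℕ b → val a ≤ᶜ val b

_⊕ᶜ_ : ∀ {C} → CVal C → ℤ → CVal C
bot ⊕ᶜ k = bot
_⊕ᶜ_ {C} (val c) k with (+ toℕ c) ℤ.+ k
... | + n      = val (fromℕ< (ℕ.s≤s (m⊓n≤m C n)))
... | -[1+ n ] = bot

IsLeast : {A : Set} → (A → A → Set) → (A → Set) → A → Set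
IsLeast _≤_ P a = P a × (∀ b → P b → a ≤ b)

IsGreatest : {A : Set} → (A → A → Set) → (A → Set) → A → Set
IsGreatest _≤_ P a = P a × (∀ b → P b → b ≤ a)

-- Literals over a finite set of propositions Fin n:
-- (p , true) is the literal p, (p , false) is the literal ¬p.

Lit : ℕ → Set
Lit n = Fin n × Bool

-- Propositions: P = Fin (nI + nO), where I = first nI indices, O = last nO.
-- Σ_I = Subset nI, Σ_O = Subset nO, Σ_P = Subset (nI + nO); o ∪ i = i ++ o.

module Game (nI nO nQ : ℕ) (q₀ : Fin nQ) (α : Subset nQ)
            (δ : Fin nQ → Subset (nI ℕ.+ nO) → Subset nQ)
            (w : Lit (nI ℕ.+ nO) → ℤ) (K C : ℕ) where

  ΣI ΣO ΣP : Set
  ΣI = Subset nI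
  ΣO = Subset nO
  ΣP = Subset (nI ℕ.+ nO)

  _∪ₚ_ : ΣO → ΣI → ΣP
  o ∪ₚ i = i ++ o

  wI : ΣI → ℤ
  wI i = foldr (λ p acc → w (p ↑ˡ nO , lookup i p) ℤ.+ acc) (+ 0) (allFin nI)

  wO : ΣO → ℤ
  wO o = foldr (λ p acc → w (nI ↑ʳ p , lookup o p) ℤ.+ acc) (+ 0) (allFin nO)

  𝓚 𝓒 𝓕 : Set
  𝓚 = KVal K
  𝓒 = CVal C
  𝓕 = Fin nQ → 𝓚

  _≤F_ : 𝓕 → 𝓕 → Set
  F ≤F G = ∀ q → F q ≤ᴷ G q

  F₀ : 𝓕
  F₀ q with q Data.Fin.≟ q₀
  ... | yes _ = fin Data.Fin.zero ⊕ᴷ lookup α q₀   -- 1 if q₀ ∈ α, else 0 (as 0 ⊕ [q₀∈α])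
  ... | no  _ = neg

  Δ : 𝓕 → ΣP → 𝓕
  Δ F σ q = foldr (λ p acc → if lookup (δ p σ) q then maxᴷ (F p ⊕ᴷ lookup α q) acc else acc)
                  neg (allFin nQ)

  data State : Set where
    s₁ : 𝓕 → ΣI → 𝓒 → State
    s₂ : 𝓕 → ΣO → 𝓒 → State

  Edge : State → State → Set
  Edge (s₁ F j c) (s₁ _ _ _)    = ⊥
  Edge (s₁ F j c) (s₂ F' o c')  = F' ≡ F × c' ≡ c ⊕ᶜ wO o
  Edge (s₂ F o c) (s₁ F' i c')  = F' ≡ Δ F (o ∪ₚ i) × c' ≡ c ⊕ᶜ wI i
  Edge (s₂ F o c) (s₂ _ _ _)    = ⊥

  IsS₁ IsS₂ : State → Set
  IsS₁ (s₁ _ _ _) = ⊤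
  IsS₁ (s₂ _ _ _) = ⊥
  IsS₂ (s₁ _ _ _) = ⊥
  IsS₂ (s₂ _ _ _) = ⊤

  _⪯_ : State → State → Set
  s₁ F' i' c' ⪯ s₁ F i c = i' ≡ i × F' ≤F F × c ≤ᶜ c'
  s₁ _ _ _    ⪯ s₂ _ _ _ = ⊥
  s₂ _ _ _    ⪯ s₁ _ _ _ = ⊥
  s₂ F' o' c' ⪯ s₂ F o c = o' ≡ o × F' ≤F F × c ≤ᶜ c'

  ↓ : Pred State 0ℓ → Pred State 0ℓ
  ↓ L s' = ∃ λ s → L s × s' ⪯ s

  Pre-o : ΣO → Pred State 0ℓ → Pred State 0ℓ
  Pre-o o L s = IsS₁ s × ∃ λ F → ∃ λ c → L (s₂ F o c) × Edge s (s₂ F o c)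

  Pre-i : ΣI → Pred State 0ℓ → Pred State 0ℓ
  Pre-i i L s = IsS₂ s × ∃ λ F → ∃ λ c → L (s₁ F i c) × Edge s (s₁ F i c)

  Ω-o : 𝓕 → ΣO → 𝓒 → Pred State 0ℓ
  Ω-o F o c s = ∃ λ i → ∃ λ c' →
    IsLeast _≤ᶜ_ (λ d → c ≤ᶜ (d ⊕ᶜ wO o)) c' × s ≡ s₁ F i c'

  Ω-i : 𝓕 → ΣI → 𝓒 → Pred State 0ℓ
  Ω-i F i c s = ∃ λ o → ∃ λ F'ₒ → ∃ λ c' →
    IsGreatest _≤F_ (λ G → Δ G (o ∪ₚ i) ≤F F) F'ₒ ×
    IsLeast _≤ᶜ_ (λ d → c ≤ᶜ (d ⊕ᶜ wI i)) c' × s ≡ s₂ F'ₒ o c'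

-- Both equalities reduce to two extremal facts. Since d ↦ d ⊕ k is monotone, the
-- budgets d with c ≤ d ⊕ k form an up-set of the finite chain 𝒞, which has a least
-- element as soon as it is inhabited. Since Δ(·,σ) is monotone and Δ(G,σ) ≤ F is a
-- conjunction of independent constraints G(p) ⊕ [q ∈ α] ≤ F(q), one for each value
-- G(p), all satisfied by -1, the counters G with Δ(G,σ) ≤ F have a pointwise greatest
-- element. Least and greatest elements of finite chains are taken as argmin/argmax of
-- an order-reflecting rank into ℕ.

module Submission where

open import Defs
open import Data.Nat using (ℕ; _+_)
open import Data.Integer using (ℤ)
open import Data.Fin using (Fin)
open import Data.Fin.Subset using (Subset)
open import Data.Product using (_×_)
open import Relation.Unary using (_≐_; ｛_｝)

open import Level using (0ℓ)
open import Data.Bool using (Bool; true; false; T; if_then_else_)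
open import Data.Nat as ℕ using (suc; z≤n; s≤s; _≤ᵇ_)
import Data.Nat.Properties as ℕ
open import Data.Integer as ℤ using (+_; -[1+_]; +≤+)
import Data.Integer.Properties as ℤ
open import Data.Fin as Fin using (toℕ)
import Data.Fin.Properties as Fin
open import Data.List using (List; []; _∷_; map; foldr; filter; allFin)
open import Data.List.Membership.Propositional using (_∈_)
open import Data.List.Membership.Propositional.Properties using (∈-allFin; ∈-map⁺; ∈-filter⁺)
open import Data.List.Relation.Unary.Any using (here; there)
import Data.List.Relation.Unary.All as All
open import Data.List.Relation.Unary.All.Properties using (all-filter)
open import Data.List.Extrema ℕ.≤-totalOrder
  using (argmin; argmax; argmin-all; argmax-all; f[argmin]≤f[xs]; f[xs]≤f[argmax])
open import Data.Product using (∃; _,_; proj₁; proj₂)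
open import Data.Empty using (⊥-elim)
open import Data.Unit using (tt)
open import Data.Vec using (lookup)
open import Function using (_∘_)
open import Relation.Nullary using (Dec; yes; no)
open import Relation.Nullary.Decidable using (map′; _→-dec_)
import Data.Bool.Properties as Bool
open import Relation.Unary using (Pred; Decidable; _⊆_)
open import Relation.Binary.PropositionalEquality using (_≡_; refl; sym; subst; subst₂)

module _ {A : Set} (rank : A → ℕ) {xs : List A} (complete : ∀ x → x ∈ xs)
         {P : Pred A 0ℓ} (P? : Decidable P) where

  least-by-rank : ∀ {z} → P z → ∃ λ m → P m × (∀ {y} → P y → rank m ℕ.≤ rank y)
  least-by-rank {z} Pz =
    argmin rank z (filter P? xs) ,
    argmin-all rank Pz (all-filter P? xs) ,
    λ Py → All.lookup (f[argmin]≤f[xs] z (filter P? xs)) (∈-filter⁺ P? (complete _) Py)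

  greatest-by-rank : ∀ {z} → P z → ∃ λ m → P m × (∀ {y} → P y → rank y ℕ.≤ rank m)
  greatest-by-rank {z} Pz =
    argmax rank z (filter P? xs) ,
    argmax-all rank Pz (all-filter P? xs) ,
    λ Py → All.lookup (f[xs]≤f[argmax] z (filter P? xs)) (∈-filter⁺ P? (complete _) Py)

module _ {C : ℕ} where

  rankᶜ : CVal C → ℕ
  rankᶜ bot     = 0
  rankᶜ (val a) = suc (toℕ a)

  rankᶜ-mono-≤ : ∀ {x y : CVal C} → x ≤ᶜ y → rankᶜ x ℕ.≤ rankᶜ y
  rankᶜ-mono-≤ bot≤       = z≤n
  rankᶜ-mono-≤ (val≤ a≤b) = s≤s a≤b

  rankᶜ-cancel-≤ : ∀ (x y : CVal C) → rankᶜ x ℕ.≤ rankᶜ y → x ≤ᶜ y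
  rankᶜ-cancel-≤ bot     y       _         = bot≤
  rankᶜ-cancel-≤ (val a) (val b) (s≤s a≤b) = val≤ a≤b

  _≤ᶜ?_ : ∀ (x y : CVal C) → Dec (x ≤ᶜ y)
  x ≤ᶜ? y = map′ (rankᶜ-cancel-≤ x y) rankᶜ-mono-≤ (rankᶜ x ℕ.≤? rankᶜ y)

  ≤ᶜ-trans : ∀ {x y z : CVal C} → x ≤ᶜ y → y ≤ᶜ z → x ≤ᶜ z
  ≤ᶜ-trans bot≤       _          = bot≤
  ≤ᶜ-trans (val≤ a≤b) (val≤ b≤c) = val≤ (ℕ.≤-trans a≤b b≤c)

  allCVal : List (CVal C)
  allCVal = bot ∷ map val (allFin (suc C))

  ∈-allCVal : ∀ x → x ∈ allCVal
  ∈-allCVal bot     = here refl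
  ∈-allCVal (val a) = there (∈-map⁺ val (∈-allFin a))

  ⊕ᶜ-monoˡ-≤ : ∀ (k : ℤ) {x y : CVal C} → x ≤ᶜ y → (x ⊕ᶜ k) ≤ᶜ (y ⊕ᶜ k)
  ⊕ᶜ-monoˡ-≤ k bot≤ = bot≤
  ⊕ᶜ-monoˡ-≤ k (val≤ {a} {b} a≤b)
    with + toℕ a ℤ.+ k | + toℕ b ℤ.+ k | ℤ.+-monoˡ-≤ k (+≤+ a≤b)
  ... | + m      | + n      | +≤+ m≤n =
    val≤ (subst₂ ℕ._≤_ (sym (Fin.toℕ-fromℕ< _)) (sym (Fin.toℕ-fromℕ< _)) (ℕ.⊓-monoʳ-≤ C m≤n))
  ... | -[1+ _ ] | _        | _       = bot≤

  least-⊕ᶜ-preimage : ∀ (k : ℤ) (c : CVal C) {d} → c ≤ᶜ (d ⊕ᶜ k) →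
                      ∃ (IsLeast _≤ᶜ_ (λ d → c ≤ᶜ (d ⊕ᶜ k)))
  least-⊕ᶜ-preimage k c {d} c≤d⊕k
    with least-by-rank rankᶜ ∈-allCVal (λ d → c ≤ᶜ? (d ⊕ᶜ k)) {d} c≤d⊕k
  ... | m , Pm , least = m , Pm , λ y Py → rankᶜ-cancel-≤ m y (least Py)

module _ {K : ℕ} where

  rankᴷ : KVal K → ℕ
  rankᴷ neg     = 0
  rankᴷ (fin a) = suc (toℕ a)
  rankᴷ top     = suc (suc K)

  rankᴷ-cancel-≤ : ∀ (x y : KVal K) → rankᴷ x ℕ.≤ rankᴷ y → x ≤ᴷ y
  rankᴷ-cancel-≤ neg     _       _         = neg≤
  rankᴷ-cancel-≤ (fin a) (fin b) (s≤s a≤b) = fin≤ a≤b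
  rankᴷ-cancel-≤ (fin a) top     _         = fin≤⊤
  rankᴷ-cancel-≤ top     (fin b) (s≤s K<b) = ⊥-elim (ℕ.<⇒≱ (Fin.toℕ<n b) K<b)
  rankᴷ-cancel-≤ top     top     _         = ⊤≤⊤

  ≤ᴷ-refl : ∀ (x : KVal K) → x ≤ᴷ x
  ≤ᴷ-refl neg     = neg≤
  ≤ᴷ-refl (fin a) = fin≤ ℕ.≤-refl
  ≤ᴷ-refl top     = ⊤≤⊤

  ≤ᴷ-trans : ∀ {x y z : KVal K} → x ≤ᴷ y → y ≤ᴷ z → x ≤ᴷ z
  ≤ᴷ-trans neg≤       _          = neg≤
  ≤ᴷ-trans (fin≤ a≤b) (fin≤ b≤c) = fin≤ (ℕ.≤-trans a≤b b≤c)
  ≤ᴷ-trans (fin≤ _)   fin≤⊤      = fin≤⊤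
  ≤ᴷ-trans fin≤⊤      ⊤≤⊤        = fin≤⊤
  ≤ᴷ-trans ⊤≤⊤        ⊤≤⊤        = ⊤≤⊤

  ≤ᴷ-top : ∀ (x : KVal K) → x ≤ᴷ top
  ≤ᴷ-top neg     = neg≤
  ≤ᴷ-top (fin _) = fin≤⊤
  ≤ᴷ-top top     = ⊤≤⊤

  _≤ᴷ?_ : ∀ (x y : KVal K) → Dec (x ≤ᴷ y)
  neg   ≤ᴷ? _     = yes neg≤
  fin a ≤ᴷ? neg   = no λ ()
  fin a ≤ᴷ? fin b = map′ fin≤ (λ { (fin≤ a≤b) → a≤b }) (toℕ a ℕ.≤? toℕ b)
  fin a ≤ᴷ? top   = yes fin≤⊤
  top   ≤ᴷ? neg   = no λ ()
  top   ≤ᴷ? fin b = no λ ()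
  top   ≤ᴷ? top   = yes ⊤≤⊤

  allKVal : List (KVal K)
  allKVal = neg ∷ top ∷ map fin (allFin (suc K))

  ∈-allKVal : ∀ x → x ∈ allKVal
  ∈-allKVal neg     = here refl
  ∈-allKVal top     = there (here refl)
  ∈-allKVal (fin a) = there (there (∈-map⁺ fin (∈-allFin a)))

  maxᴷ-upperˡ : ∀ (x y : KVal K) → x ≤ᴷ maxᴷ x y
  maxᴷ-upperˡ neg     _       = neg≤
  maxᴷ-upperˡ top     _       = ⊤≤⊤
  maxᴷ-upperˡ (fin a) neg     = ≤ᴷ-refl (fin a)
  maxᴷ-upperˡ (fin a) top     = fin≤⊤
  maxᴷ-upperˡ (fin a) (fin b) with toℕ a ≤ᵇ toℕ b in a≤ᵇb
  ... | true  = fin≤ (ℕ.≤ᵇ⇒≤ (toℕ a) (toℕ b) (subst T (sym a≤ᵇb) tt))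
  ... | false = ≤ᴷ-refl (fin a)

  maxᴷ-upperʳ : ∀ (x y : KVal K) → y ≤ᴷ maxᴷ x y
  maxᴷ-upperʳ neg     y       = ≤ᴷ-refl y
  maxᴷ-upperʳ top     y       = ≤ᴷ-top y
  maxᴷ-upperʳ (fin a) neg     = neg≤
  maxᴷ-upperʳ (fin a) top     = ⊤≤⊤
  maxᴷ-upperʳ (fin a) (fin b) with toℕ a ≤ᵇ toℕ b in a≤ᵇb
  ... | true  = ≤ᴷ-refl (fin b)
  ... | false = fin≤ (ℕ.≰⇒≥ λ a≤b → subst T a≤ᵇb (ℕ.≤⇒≤ᵇ a≤b))

  maxᴷ-lub : ∀ (x y : KVal K) {z} → x ≤ᴷ z → y ≤ᴷ z → maxᴷ x y ≤ᴷ z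
  maxᴷ-lub neg     _       _   y≤z = y≤z
  maxᴷ-lub top     _       x≤z _   = x≤z
  maxᴷ-lub (fin a) neg     x≤z _   = x≤z
  maxᴷ-lub (fin a) top     _   y≤z = y≤z
  maxᴷ-lub (fin a) (fin b) x≤z y≤z with toℕ a ≤ᵇ toℕ b
  ... | true  = y≤z
  ... | false = x≤z

  ⊕ᴷ-monoˡ-≤ : ∀ (b : Bool) {x y : KVal K} → x ≤ᴷ y → (x ⊕ᴷ b) ≤ᴷ (y ⊕ᴷ b)
  ⊕ᴷ-monoˡ-≤ b neg≤ = neg≤
  ⊕ᴷ-monoˡ-≤ b ⊤≤⊤  = ⊤≤⊤
  ⊕ᴷ-monoˡ-≤ b (fin≤⊤ {a}) = ≤ᴷ-top (fin a ⊕ᴷ b)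
  ⊕ᴷ-monoˡ-≤ b (fin≤ {a} {a′} a≤a′)
    with toℕ a + bit b ℕ.≤? K | toℕ a′ + bit b ℕ.≤? K
  ... | yes p | yes p′ =
    fin≤ (subst₂ ℕ._≤_ (sym (Fin.toℕ-fromℕ< (s≤s p))) (sym (Fin.toℕ-fromℕ< (s≤s p′)))
                 (ℕ.+-monoˡ-≤ (bit b) a≤a′))
  ... | yes _ | no _   = fin≤⊤
  ... | no ¬p | yes p′ = ⊥-elim (¬p (ℕ.≤-trans (ℕ.+-monoˡ-≤ (bit b) a≤a′) p′))
  ... | no _  | no _   = ⊤≤⊤

  maxᴷ-over : {A : Set} → (A → Bool) → (A → KVal K) → List A → KVal K
  maxᴷ-over b f = foldr (λ p acc → if b p then maxᴷ (f p) acc else acc) neg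

  maxᴷ-over-upper : ∀ {A : Set} (b : A → Bool) (f : A → KVal K) {ps p} →
                    p ∈ ps → b p ≡ true → f p ≤ᴷ maxᴷ-over b f ps
  maxᴷ-over-upper b f {x ∷ _} (here refl) bx rewrite bx = maxᴷ-upperˡ (f x) _
  maxᴷ-over-upper b f {x ∷ xs} (there p∈xs) bp with b x
  ... | true  = ≤ᴷ-trans (maxᴷ-over-upper b f p∈xs bp) (maxᴷ-upperʳ (f x) _)
  ... | false = maxᴷ-over-upper b f p∈xs bp

  maxᴷ-over-lub : ∀ {A : Set} (b : A → Bool) (f : A → KVal K) (ps : List A) {z} →
                  (∀ {p} → p ∈ ps → b p ≡ true → f p ≤ᴷ z) → maxᴷ-over b f ps ≤ᴷ z
  maxᴷ-over-lub b f []       bound = neg≤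
  maxᴷ-over-lub b f (x ∷ xs) bound with b x in bx
  ... | true  = maxᴷ-lub (f x) _ (bound (here refl) bx) (maxᴷ-over-lub b f xs (bound ∘ there))
  ... | false = maxᴷ-over-lub b f xs (bound ∘ there)

module _ (nI nO nQ : ℕ) (q₀ : Fin nQ) (α : Subset nQ)
         (δ : Fin nQ → Subset (nI + nO) → Subset nQ)
         (w : Lit (nI + nO) → ℤ) (K C : ℕ) where

  open Game nI nO nQ q₀ α δ w K C

  ≤F-trans : ∀ {F G H} → F ≤F G → G ≤F H → F ≤F H
  ≤F-trans F≤G G≤H q = ≤ᴷ-trans (F≤G q) (G≤H q)

  Δ-upper : ∀ G σ {p q} → lookup (δ p σ) q ≡ true → (G p ⊕ᴷ lookup α q) ≤ᴷ Δ G σ q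
  Δ-upper G σ {p} {q} p→q =
    maxᴷ-over-upper (λ p → lookup (δ p σ) q) (λ p → G p ⊕ᴷ lookup α q) (∈-allFin p) p→q

  Δ-lub : ∀ G σ {q z} → (∀ p → lookup (δ p σ) q ≡ true → (G p ⊕ᴷ lookup α q) ≤ᴷ z) → Δ G σ q ≤ᴷ z
  Δ-lub G σ {q} bound =
    maxᴷ-over-lub (λ p → lookup (δ p σ) q) (λ p → G p ⊕ᴷ lookup α q) (allFin nQ) (λ {p} _ → bound p)

  Δ-monoˡ-≤ : ∀ {G G′} σ → G ≤F G′ → Δ G σ ≤F Δ G′ σ
  Δ-monoˡ-≤ {G} {G′} σ G≤G′ q =
    Δ-lub G σ λ p p→q → ≤ᴷ-trans (⊕ᴷ-monoˡ-≤ (lookup α q) (G≤G′ p)) (Δ-upper G′ σ p→q)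

  Admissible : 𝓕 → ΣP → Fin nQ → 𝓚 → Set
  Admissible F σ p k = ∀ q → lookup (δ p σ) q ≡ true → (k ⊕ᴷ lookup α q) ≤ᴷ F q

  admissible? : ∀ F σ p → Decidable (Admissible F σ p)
  admissible? F σ p k = Fin.all? λ q → (lookup (δ p σ) q Bool.≟ true) →-dec ((k ⊕ᴷ lookup α q) ≤ᴷ? F q)

  Δ≤⇒admissible : ∀ G {F} σ → Δ G σ ≤F F → ∀ p → Admissible F σ p (G p)
  Δ≤⇒admissible G σ Δ≤F p q p→q = ≤ᴷ-trans (Δ-upper G σ p→q) (Δ≤F q)

  admissible⇒Δ≤ : ∀ G {F} σ → (∀ p → Admissible F σ p (G p)) → Δ G σ ≤F F
  admissible⇒Δ≤ G σ adm q = Δ-lub G σ λ p p→q → adm p q p→q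

  greatest-Δ-preimage : ∀ F σ → ∃ (IsGreatest _≤F_ (λ G → Δ G σ ≤F F))
  greatest-Δ-preimage F σ =
    G* , admissible⇒Δ≤ G* σ (proj₁ ∘ proj₂ ∘ greatest) ,
    λ G Δ≤F p → rankᴷ-cancel-≤ (G p) (G* p) (proj₂ (proj₂ (greatest p)) (Δ≤⇒admissible G σ Δ≤F p))
    where
    greatest : ∀ p → ∃ λ m → Admissible F σ p m × (∀ {k} → Admissible F σ p k → rankᴷ k ℕ.≤ rankᴷ m)
    greatest p = greatest-by-rank rankᴷ ∈-allKVal (admissible? F σ p) {neg} (λ _ _ → neg≤)
    G* : 𝓕
    G* = proj₁ ∘ greatest

  Pre-o-↓≐↓Ω-o : ∀ F o c → Pre-o o (↓ ｛ s₂ F o c ｝) ≐ ↓ (Ω-o F o c)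
  Pre-o-↓≐↓Ω-o F o c = ⊆↓Ω , ↓Ω⊆
    where
    ⊆↓Ω : Pre-o o (↓ ｛ s₂ F o c ｝) ⊆ ↓ (Ω-o F o c)
    ⊆↓Ω {s₁ F′ j d} (_ , _ , _ , (_ , refl , refl , F′≤F , c≤d⊕) , refl , refl)
      with least-⊕ᶜ-preimage (wO o) c {d} c≤d⊕
    ... | c′ , c≤c′⊕ , least =
      s₁ F j c′ , (j , c′ , (c≤c′⊕ , least) , refl) , refl , F′≤F , least d c≤d⊕

    ↓Ω⊆ : ↓ (Ω-o F o c) ⊆ Pre-o o (↓ ｛ s₂ F o c ｝)
    ↓Ω⊆ {s₁ F′ j d} (_ , (_ , _ , (c≤c′⊕ , _) , refl) , refl , F′≤F , c′≤d) =
      tt , F′ , d ⊕ᶜ wO o ,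
      (s₂ F o c , refl , refl , F′≤F , ≤ᶜ-trans c≤c′⊕ (⊕ᶜ-monoˡ-≤ (wO o) c′≤d)) , refl , refl
    ↓Ω⊆ {s₂ _ _ _} (_ , (_ , _ , _ , refl) , ())

  Pre-i-↓≐↓Ω-i : ∀ F i c → Pre-i i (↓ ｛ s₁ F i c ｝) ≐ ↓ (Ω-i F i c)
  Pre-i-↓≐↓Ω-i F i c = ⊆↓Ω , ↓Ω⊆
    where
    ⊆↓Ω : Pre-i i (↓ ｛ s₁ F i c ｝) ⊆ ↓ (Ω-i F i c)
    ⊆↓Ω {s₂ G o d} (_ , _ , _ , (_ , refl , refl , ΔG≤F , c≤d⊕) , refl , refl)
      with least-⊕ᶜ-preimage (wI i) c {d} c≤d⊕ | greatest-Δ-preimage F (o ∪ₚ i)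
    ... | c′ , c≤c′⊕ , least | G* , ΔG*≤F , greatest =
      s₂ G* o c′ , (o , G* , c′ , (ΔG*≤F , greatest) , (c≤c′⊕ , least) , refl) ,
      refl , greatest G ΔG≤F , least d c≤d⊕

    ↓Ω⊆ : ↓ (Ω-i F i c) ⊆ Pre-i i (↓ ｛ s₁ F i c ｝)
    ↓Ω⊆ {s₂ G o d} (_ , (_ , _ , _ , (ΔG*≤F , _) , (c≤c′⊕ , _) , refl) , refl , G≤G* , c′≤d) =
      tt , Δ G (o ∪ₚ i) , d ⊕ᶜ wI i ,
      (s₁ F i c , refl , refl , ≤F-trans (Δ-monoˡ-≤ (o ∪ₚ i) G≤G*) ΔG*≤F ,
        ≤ᶜ-trans c≤c′⊕ (⊕ᶜ-monoˡ-≤ (wI i) c′≤d)) ,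
      refl , refl
    ↓Ω⊆ {s₁ _ _ _} (_ , (_ , _ , _ , _ , _ , refl) , ())

proposition8 : (nI nO nQ : ℕ) (q₀ : Fin nQ) (α : Subset nQ)
    (δ : Fin nQ → Subset (nI + nO) → Subset nQ)
    (w : Lit (nI + nO) → ℤ) (K C : ℕ) →
    let open Game nI nO nQ q₀ α δ w K C in
    (∀ (F : 𝓕) (o : ΣO) (c : 𝓒) → Pre-o o (↓ ｛ s₂ F o c ｝) ≐ ↓ (Ω-o F o c))
    × (∀ (F : 𝓕) (i : ΣI) (c : 𝓒) → Pre-i i (↓ ｛ s₁ F i c ｝) ≐ ↓ (Ω-i F i c))
proposition8 nI nO nQ q₀ α δ w K C =
  Pre-o-↓≐↓Ω-o nI nO nQ q₀ α δ w K C , Pre-i-↓≐↓Ω-i nI nO nQ q₀ α δ w K C
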